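{- Let $\pi$ be a projective plane of order $q$ with $q$ even, and let $\Gamma_\pi$ be its incidence graph. If the line graph $L(\Gamma_\pi)$ is a Cayley graph, then $\pi$ has a collineation group acting regularly on its flags.
   Context: A projective plane of order $q$ is a point-line incidence structure in which every line has $q+1$ points, every point is on $q+1$ lines, and any two points lie on a unique line. Its incidence graph $\Gamma_\pi$ is the bipartite graph on points and lines with adjacency given by incidence. A flag is an incident point-line pair (i.e. an edge of $\Gamma_\pi$). A collineation is a permutation of points and lines mapping points to points and lines to lines and preserving incidence. A graph is a Cayley graph if it is isomorphic to $\mathrm{Cay}(G,S)$ for some finite group $G$ and inverse-closed $S\subseteq G\setminus\{e\}$, where $a\sim b$ iff $ab^{ -1}\in S$. -}

module Defs where

open import Level using (0ℓ)
open import Data.Nat using (ℕ; suc)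
open import Data.Fin using (Fin)
open import Data.Fin.Permutation using (Permutation′; _⟨$⟩ʳ_; _⟨$⟩ˡ_; id; flip; _∘ₚ_)
open import Data.Bool using (Bool; true)
open import Data.Product using (Σ; Σ-syntax; ∃; ∃-syntax; _×_; _,_; proj₁; proj₂)
open import Data.Sum using (_⊎_)
open import Function.Bundles using (_↔_; _⇔_)
open import Relation.Binary.PropositionalEquality using (_≡_; _≢_)
open import Relation.Nullary using (¬_)
open import Algebra.Bundles using (Group)

record ProjectivePlane (q : ℕ) : Set where
  field
    v b : ℕ
    I   : Fin v → Fin b → Bool
    linePoints : ∀ (l : Fin b) → Fin (suc q) ↔ (Σ[ p ∈ Fin v ] I p l ≡ true)
    pointLines : ∀ (p : Fin v) → Fin (suc q) ↔ (Σ[ l ∈ Fin b ] I p l ≡ true)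
    joinUnique : ∀ (p p′ : Fin v) → p ≢ p′ →
                 Σ[ l ∈ Fin b ] (I p l ≡ true × I p′ l ≡ true ×
                   (∀ (l′ : Fin b) → I p l′ ≡ true → I p′ l′ ≡ true → l′ ≡ l))

record Graph : Set₁ where
  field
    V   : Set
    Adj : V → V → Set

module _ {q : ℕ} (π : ProjectivePlane q) where
  open ProjectivePlane π

  data IncAdj : Fin v ⊎ Fin b → Fin v ⊎ Fin b → Set where
    pl : ∀ p l → I p l ≡ true → IncAdj (Data.Sum.inj₁ p) (Data.Sum.inj₂ l)
    lp : ∀ p l → I p l ≡ true → IncAdj (Data.Sum.inj₂ l) (Data.Sum.inj₁ p)

  IncidenceGraph : Graph
  IncidenceGraph = record { V = Fin v ⊎ Fin b ; Adj = IncAdj }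

  Flag : Set
  Flag = Σ[ pl ∈ Fin v × Fin b ] I (proj₁ pl) (proj₂ pl) ≡ true

  flagPoint : Flag → Fin v
  flagPoint ((p , _) , _) = p

  flagLine : Flag → Fin b
  flagLine ((_ , l) , _) = l

  -- Line graph L(Γ_π): vertices are the edges (flags) of Γ_π, two distinct
  -- edges adjacent iff they share an end vertex (a point or a line).
  LineGraphAdj : Flag → Flag → Set
  LineGraphAdj f f′ = (flagPoint f , flagLine f) ≢ (flagPoint f′ , flagLine f′)
                    × (flagPoint f ≡ flagPoint f′ ⊎ flagLine f ≡ flagLine f′)

  LineGraphOfIncidenceGraph : Graph
  LineGraphOfIncidenceGraph = record { V = Flag ; Adj = LineGraphAdj }

  record Collineation : Set where
    field
      σ : Permutation′ v
      τ : Permutation′ b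
      preserves : ∀ p l → I (σ ⟨$⟩ʳ p) (τ ⟨$⟩ʳ l) ≡ I p l

  open Collineation

  _≈c_ : Collineation → Collineation → Set
  α ≈c β = (∀ p → σ α ⟨$⟩ʳ p ≡ σ β ⟨$⟩ʳ p) × (∀ l → τ α ⟨$⟩ʳ l ≡ τ β ⟨$⟩ʳ l)

  MapsFlag : Collineation → Flag → Flag → Set
  MapsFlag α f f′ = (σ α ⟨$⟩ʳ flagPoint f ≡ flagPoint f′) × (τ α ⟨$⟩ʳ flagLine f ≡ flagLine f′)

  record IsCollineationGroup (H : Collineation → Set) : Set where
    field
      respects : ∀ α β → α ≈c β → H α → H β
      hasId    : ∀ α → (∀ p → σ α ⟨$⟩ʳ p ≡ p) → (∀ l → τ α ⟨$⟩ʳ l ≡ l) → H α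
      closedComp : ∀ α β γ → H α → H β →
                   (∀ p → σ γ ⟨$⟩ʳ p ≡ σ α ⟨$⟩ʳ (σ β ⟨$⟩ʳ p)) →
                   (∀ l → τ γ ⟨$⟩ʳ l ≡ τ α ⟨$⟩ʳ (τ β ⟨$⟩ʳ l)) → H γ
      closedInv  : ∀ α β → H α →
                   (∀ p → σ β ⟨$⟩ʳ p ≡ σ α ⟨$⟩ˡ p) →
                   (∀ l → τ β ⟨$⟩ʳ l ≡ τ α ⟨$⟩ˡ l) → H β

  ActsRegularlyOnFlags : (Collineation → Set) → Set
  ActsRegularlyOnFlags H =
    ∀ (f f′ : Flag) →
      (Σ[ α ∈ Collineation ] (H α × MapsFlag α f f′)) ×
      (∀ α β → H α → H β → MapsFlag α f f′ → MapsFlag β f f′ → α ≈c β)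

  HasFlagRegularCollineationGroup : Set₁
  HasFlagRegularCollineationGroup =
    Σ[ H ∈ (Collineation → Set) ] (IsCollineationGroup H × ActsRegularlyOnFlags H)

-- The graph
-- isomorphism φ : V → G is a bijection up to ≈ (which in particular
-- makes G finite whenever V is finite; finiteness is also stated
-- explicitly).

IsCayleyGraph : Graph → Set₁
IsCayleyGraph Γ =
  Σ[ G ∈ Group 0ℓ 0ℓ ] (let open Group G in
  (Σ[ n ∈ ℕ ] Σ[ e ∈ (Fin n → Carrier) ] (∀ g → Σ[ i ∈ Fin n ] e i ≈ g)) ×
  Σ[ S ∈ (Carrier → Set) ]
    ((∀ {g h} → g ≈ h → S g → S h) ×
     ¬ S ε ×
     (∀ g → S g → S (g ⁻¹)) ×
     Σ[ φ ∈ (V → Carrier) ]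
       ((∀ x y → φ x ≈ φ y → x ≡ y) ×
        (∀ g → Σ[ x ∈ V ] φ x ≈ g) ×
        (∀ x y → Adj x y ⇔ S (φ x ∙ φ y ⁻¹)))))
  where open Graph Γ

module Submission where

-- Transport the right regular action of G to the flags along the
-- Cayley labelling φ; each act h is an embedding of L(Γ_π).  The
-- neighbourhood of a flag is a point-clique plus a line-clique with no
-- edges between them, so (Whitney-type rigidity, using that L(Γ_π) is
-- connected) an embedding either keeps the kind "shared point / shared
-- line" of every adjacency or exchanges it for every adjacency.  This
-- twist is a homomorphism G → (Bool, xor).  An element exchanging kinds
-- would flip the labelling x ↦ twist (φ x) of the flags, making their
-- number (q² + q + 1)(q + 1) even, which fails for even q.  So every act h
-- respects common points and common lines, hence is induced by a
-- collineation, and these collineations form a group that acts regularly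
-- on the flags because G does.  (For q = 0 there are no adjacencies.)

open import Defs
open import Level using (0ℓ)
open import Data.Nat using (ℕ; zero; suc; _+_; _*_)
open import Data.Nat.Properties using (+-comm; *-suc; *-identityʳ; +-0-commutativeMonoid)
open import Data.Nat.Divisibility using (_∣_; divides; ∣1⇒≡1; ∣m+n∣m⇒∣n; ∣n⇒∣m*n)
open import Data.Nat.Primality using (euclidsLemma; prime[2])
open import Data.Fin using (Fin; zero; suc; punchIn; punchOut; _≟_)
open import Data.Fin.Properties using (punchInᵢ≢i; punchOut-cong; punchIn-punchOut; punchOut-punchIn; *↔×; +↔⊎; 1↔⊤)
open import Data.Fin.Permutation using (Permutation′; _⟨$⟩ʳ_; _⟨$⟩ˡ_; ↔⇒≡; permutation) renaming (inverseˡ to permutation-inverseˡ)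
open import Data.Bool using (Bool; true; false; not; _xor_; if_then_else_)
open import Data.Bool.Properties using (not-injective; xor-assoc; xor-comm; ⇔→≡) renaming (_≟_ to _≟ᵇ_)
open import Data.Unit using (⊤; tt)
open import Data.Empty using (⊥-elim; ⊥-elim-irr)
open import Data.Product using (Σ; Σ-syntax; _×_; _,_; proj₁; proj₂)
open import Data.Product.Algebra using (Σ-assoc-alt)
open import Data.Product.Function.Dependent.Propositional using (Σ-↔)
open import Data.Sum using (_⊎_; inj₁; inj₂)
open import Data.Sum.Function.Propositional using (_⊎-↔_)
open import Function.Bundles using (_↔_; mk↔ₛ′; Inverse; _⇔_; mk⇔; Equivalence)
open import Function.Properties.Inverse using (↔-refl; ↔-sym; ↔-trans)
open import Relation.Binary.Definitions using (DecidableEquality)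
open import Relation.Binary.PropositionalEquality using (_≡_; _≢_; refl; sym; trans; cong; cong₂; subst; module ≡-Reasoning)
open import Relation.Nullary using (¬_; Dec; yes; no; does; contradiction)
open import Relation.Nullary.Decidable using (map′; _×-dec_; dec-true; dec-false; does-⇔)
open import Relation.Nullary.Recomputable using (¬-recompute)
open import Algebra.Bundles using (Group)
import Algebra.Properties.Group as GroupProperties
import Relation.Binary.Reasoning.Setoid as SetoidReasoning
open import Axiom.UniquenessOfIdentityProofs using (module Decidable⇒UIP)
open import Algebra.Properties.CommutativeMonoid.Sum +-0-commutativeMonoid using (sum; sum-permute; ∑-distrib-+; sum-cong-≗)

open Inverse using (to; from; strictlyInverseˡ; strictlyInverseʳ)

infix 5 _∖_

-- The elements of A other than a₀.  The distinctness proof is irrelevant,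
-- so two elements of A ∖ a₀ are equal as soon as their underlying
-- elements are.
record _∖_ (A : Set) (a₀ : A) : Set where
  constructor _,_
  field
    elem : A
    .distinct : elem ≢ a₀
open _∖_

module _ {A : Set} where

  ∖-≡ : {a₀ : A} {x y : A ∖ a₀} → elem x ≡ elem y → x ≡ y
  ∖-≡ refl = refl

  -- Distinctness is a negation, hence can be recovered relevantly.
  distinct′ : {a₀ : A} (x : A ∖ a₀) → elem x ≢ a₀
  distinct′ (_ , a≢a₀) = ¬-recompute a≢a₀

  split-↔ : DecidableEquality A → (a₀ : A) → A ↔ (⊤ ⊎ A ∖ a₀)
  split-↔ _≟A_ a₀ = mk↔ₛ′ forward backward forward∘backward backward∘forward
    where
    forward : A → ⊤ ⊎ A ∖ a₀
    forward a with a ≟A a₀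
    ... | yes _    = inj₁ tt
    ... | no a≢a₀ = inj₂ (a , a≢a₀)
    backward : ⊤ ⊎ A ∖ a₀ → A
    backward (inj₁ _) = a₀
    backward (inj₂ x) = elem x
    forward∘backward : ∀ y → forward (backward y) ≡ y
    forward∘backward (inj₁ tt) with a₀ ≟A a₀
    ... | yes _    = refl
    ... | no a₀≢a₀ = ⊥-elim-irr (a₀≢a₀ refl)
    forward∘backward (inj₂ (a , a≢a₀)) with a ≟A a₀
    ... | yes a≡a₀ = ⊥-elim-irr (a≢a₀ a≡a₀)
    ... | no _     = refl
    backward∘forward : ∀ a → backward (forward a) ≡ a
    backward∘forward a with a ≟A a₀
    ... | yes a≡a₀ = sym a≡a₀
    ... | no _     = refl

∖-↔ : {A B : Set} (e : A ↔ B) (b₀ : B) → (A ∖ from e b₀) ↔ (B ∖ b₀)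
∖-↔ e b₀ = mk↔ₛ′ forward backward (λ y → ∖-≡ (strictlyInverseˡ e (elem y)))
                                  (λ x → ∖-≡ (strictlyInverseʳ e (elem x)))
  where
  forward : _ ∖ from e b₀ → _ ∖ b₀
  forward (a , a≢) = to e a , λ eq → a≢ (trans (sym (strictlyInverseʳ e a)) (cong (from e) eq))
  backward : _ ∖ b₀ → _ ∖ from e b₀
  backward (b , b≢) = from e b , λ eq →
    b≢ (trans (sym (strictlyInverseˡ e b)) (trans (cong (to e) eq) (strictlyInverseˡ e b₀)))

punch-↔ : ∀ {n} (i : Fin (suc n)) → Fin n ↔ (Fin (suc n) ∖ i)
punch-↔ i = mk↔ₛ′ (λ j → punchIn i j , punchInᵢ≢i i j)
                  (λ x → punchOut (λ i≡ → distinct′ x (sym i≡)))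
                  (λ x → ∖-≡ (punchIn-punchOut _))
                  (λ j → trans (punchOut-cong i refl) (punchOut-punchIn i))

remove-↔ : ∀ {n} {A : Set} → Fin (suc n) ↔ A → (a₀ : A) → Fin n ↔ (A ∖ a₀)
remove-↔ e a₀ = ↔-trans (punch-↔ (from e a₀)) (∖-↔ e a₀)

suc-↔ : ∀ n → Fin (suc n) ↔ (⊤ ⊎ Fin n)
suc-↔ n = ↔-trans (+↔⊎ {1} {n}) (1↔⊤ ⊎-↔ ↔-refl)

⟨$⟩ˡ-unique : ∀ {n} (ρ : Permutation′ n) {i j} → ρ ⟨$⟩ʳ j ≡ i → ρ ⟨$⟩ˡ i ≡ j
⟨$⟩ˡ-unique ρ eq = trans (cong (ρ ⟨$⟩ˡ_) (sym eq)) (permutation-inverseˡ ρ)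

bool-uip : {a b : Bool} (e e′ : a ≡ b) → e ≡ e′
bool-uip = Decidable⇒UIP.≡-irrelevant _≟ᵇ_

guarded-≡ : {A : Set} (f : A → Bool) {x y : Σ[ a ∈ A ] f a ≡ true} → proj₁ x ≡ proj₁ y → x ≡ y
guarded-≡ f {a , e} {.a , e′} refl = cong (a ,_) (bool-uip e e′)

xor-cancelˡ : ∀ s {c d} → s xor c ≡ s xor d → c ≡ d
xor-cancelˡ false eq = eq
xor-cancelˡ true  eq = not-injective eq

xor-shift : ∀ u w β → (u ≡ β ⇔ w ≡ true) → u ≡ w xor not β
xor-shift true  true  true  _ = refl
xor-shift true  false true  h = sym (Equivalence.to h refl)
xor-shift false true  true  h = Equivalence.from h refl
xor-shift false false true  _ = refl
xor-shift true  true  false h = Equivalence.from h refl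
xor-shift true  false false _ = refl
xor-shift false true  false _ = refl
xor-shift false false false h = Equivalence.to h refl

indicator : Bool → ℕ
indicator b = if b then 1 else 0

indicator-split : ∀ b → 1 ≡ indicator b + indicator (not b)
indicator-split true  = refl
indicator-split false = refl

sum-ones : ∀ N → sum {N} (λ _ → 1) ≡ N
sum-ones zero    = refl
sum-ones (suc N) = cong suc (sum-ones N)

-- If a permutation ρ of a set of size N flips a Boolean labelling t, then
-- N is even: ρ exchanges the true- and the false-labelled elements.
flip⇒even : ∀ {N} {A : Set} (e : Fin N ↔ A) (ρ : A ↔ A) (t : A → Bool) →
            (∀ a → t (to ρ a) ≡ not (t a)) → 2 ∣ N
flip⇒even {N} e ρ t flips = divides trues (begin
  N                                                   ≡⟨ sym (sum-ones N) ⟩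
  sum {N} (λ _ → 1)                                   ≡⟨ sum-cong-≗ (λ i → indicator-split (t′ i)) ⟩
  sum (λ i → indicator (t′ i) + indicator (not (t′ i))) ≡⟨ ∑-distrib-+ (λ i → indicator (t′ i)) _ ⟩
  trues + sum (λ i → indicator (not (t′ i)))          ≡⟨ cong (trues +_) falses≡trues ⟩
  trues + trues                                       ≡⟨ cong (trues +_) (sym (*-identityʳ trues)) ⟩
  trues + trues * 1                                   ≡⟨ sym (*-suc trues 1) ⟩
  trues * 2                                           ∎)
  where
  open ≡-Reasoning
  t′ : Fin N → Bool
  t′ i = t (to e i)
  ρ′ : Permutation′ N
  ρ′ = ↔-trans e (↔-trans ρ (↔-sym e))
  trues : ℕ
  trues = sum (λ i → indicator (t′ i))
  t′-flips : ∀ i → indicator (t′ (ρ′ ⟨$⟩ʳ i)) ≡ indicator (not (t′ i))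
  t′-flips i = cong indicator (trans (cong t (strictlyInverseˡ e _)) (flips (to e i)))
  falses≡trues : sum (λ i → indicator (not (t′ i))) ≡ trues
  falses≡trues = trans (sym (sum-cong-≗ t′-flips)) (sym (sum-permute _ ρ′))

even⇒odd-suc : ∀ {n} → 2 ∣ n → ¬ 2 ∣ suc n
even⇒odd-suc {n} 2∣n 2∣1+n with ∣1⇒≡1 (∣m+n∣m⇒∣n (subst (2 ∣_) (+-comm 1 n) 2∣1+n) 2∣n)
... | ()

-- For even q, the number (q² + q + 1)(q + 1) of flags of a plane of order q is odd.
flag-count-odd : ∀ q → 2 ∣ q → ¬ 2 ∣ suc (suc q * q) * suc q
flag-count-odd q 2∣q 2∣N with euclidsLemma (suc (suc q * q)) (suc q) prime[2] 2∣N
... | inj₁ 2∣points = even⇒odd-suc (∣n⇒∣m*n (suc q) 2∣q) 2∣points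
... | inj₂ 2∣1+q    = even⇒odd-suc 2∣q 2∣1+q

module PlaneCounting {q : ℕ} (π : ProjectivePlane q) where
  open ProjectivePlane π

  LinesThrough : Fin v → Set
  LinesThrough p = Σ[ l ∈ Fin b ] I p l ≡ true

  PointsOn : Fin b → Set
  PointsOn l = Σ[ p ∈ Fin v ] I p l ≡ true

  OthersOn : (p₀ : Fin v) → LinesThrough p₀ → Set
  OthersOn p₀ (l , p₀∈l) = PointsOn l ∖ (p₀ , p₀∈l)

  others-↔ : (p₀ : Fin v) → (Fin v ∖ p₀) ↔ Σ (LinesThrough p₀) (OthersOn p₀)
  others-↔ p₀ = mk↔ₛ′ forward backward forward∘backward (λ _ → refl)
    where
    Join : Fin v → Set
    Join p = Σ[ l ∈ Fin b ] (I p₀ l ≡ true × I p l ≡ true ×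
               (∀ l′ → I p₀ l′ ≡ true → I p l′ ≡ true → l′ ≡ l))
    viaJoin : (x : Fin v ∖ p₀) → Join (elem x) → Σ (LinesThrough p₀) (OthersOn p₀)
    viaJoin (p , p≢p₀) (l , p₀∈l , p∈l , _) =
      (l , p₀∈l) , ((p , p∈l) , λ eq → p≢p₀ (cong proj₁ eq))
    forward : Fin v ∖ p₀ → Σ (LinesThrough p₀) (OthersOn p₀)
    forward x = viaJoin x (joinUnique p₀ (elem x) (λ eq → distinct′ x (sym eq)))
    backward : Σ (LinesThrough p₀) (OthersOn p₀) → Fin v ∖ p₀
    backward ((l , _) , ((p , _) , p≢p₀)) = p , λ eq → p≢p₀ (guarded-≡ (λ p → I p l) eq)
    viaJoin-unique : ∀ y (J : Join (elem (backward y))) → viaJoin (backward y) J ≡ y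
    viaJoin-unique ((l , p₀∈l) , ((p , p∈l) , _)) (l′ , p₀∈l′ , p∈l′ , unique)
      with unique l p₀∈l p∈l
    ... | refl rewrite bool-uip p₀∈l p₀∈l′ | bool-uip p∈l p∈l′ = refl
    forward∘backward : ∀ y → forward (backward y) ≡ y
    forward∘backward y = viaJoin-unique y (joinUnique p₀ (elem (backward y)) _)

  -- A plane of order q has q² + q + 1 points: those other than p₀ are
  -- counted along the q + 1 lines through p₀.
  point-count : Fin v → v ≡ suc (suc q * q)
  point-count p₀ = sym (↔⇒≡ (↔-trans (suc-↔ _)
                     (↔-trans (↔-refl ⊎-↔ count-others) (↔-sym (split-↔ _≟_ p₀)))))
    where
    count-others : Fin (suc q * q) ↔ (Fin v ∖ p₀)
    count-others = ↔-trans *↔×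
      (↔-trans (Σ-↔ {B = OthersOn p₀} (pointLines p₀) (remove-↔ (linePoints _) _))
               (↔-sym (others-↔ p₀)))

  flag-↔ : Fin (v * suc q) ↔ Flag π
  flag-↔ = ↔-trans *↔× (↔-trans (Σ-↔ ↔-refl (λ {p} → pointLines p)) (↔-sym Σ-assoc-alt))

module LineGraph {q : ℕ} (π : ProjectivePlane q) where
  open ProjectivePlane π

  pt : Flag π → Fin v
  pt = flagPoint π

  ln : Flag π → Fin b
  ln = flagLine π

  flag-≡ : {x y : Flag π} → pt x ≡ pt y → ln x ≡ ln y → x ≡ y
  flag-≡ refl refl = guarded-≡ (λ pl → I (proj₁ pl) (proj₂ pl)) refl

  flag-≟ : DecidableEquality (Flag π)
  flag-≟ x y = map′ (λ (p≡ , l≡) → flag-≡ p≡ l≡) (λ eq → cong pt eq , cong ln eq)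
                    (pt x ≟ pt y ×-dec ln x ≟ ln y)

  data Adjacent (x y : Flag π) : Set where
    viaPoint : x ≢ y → pt x ≡ pt y → Adjacent x y
    viaLine  : x ≢ y → ln x ≡ ln y → Adjacent x y

  adjacent⇔ : ∀ x y → Adjacent x y ⇔ LineGraphAdj π x y
  adjacent⇔ x y = mk⇔ forward backward
    where
    distinct-pairs : x ≢ y → (pt x , ln x) ≢ (pt y , ln y)
    distinct-pairs x≢y eq = x≢y (flag-≡ (cong proj₁ eq) (cong proj₂ eq))
    forward : Adjacent x y → LineGraphAdj π x y
    forward (viaPoint x≢y p≡) = distinct-pairs x≢y , inj₁ p≡
    forward (viaLine  x≢y l≡) = distinct-pairs x≢y , inj₂ l≡
    backward : LineGraphAdj π x y → Adjacent x y
    backward (pairs≢ , inj₁ p≡) = viaPoint (λ eq → pairs≢ (cong (λ z → pt z , ln z) eq)) p≡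
    backward (pairs≢ , inj₂ l≡) = viaLine  (λ eq → pairs≢ (cong (λ z → pt z , ln z) eq)) l≡

  adjacent-≢ : ∀ {x y} → Adjacent x y → x ≢ y
  adjacent-≢ (viaPoint x≢y _) = x≢y
  adjacent-≢ (viaLine  x≢y _) = x≢y

  adjacent-sym : ∀ {x y} → Adjacent x y → Adjacent y x
  adjacent-sym (viaPoint x≢y p≡) = viaPoint (λ eq → x≢y (sym eq)) (sym p≡)
  adjacent-sym (viaLine  x≢y l≡) = viaLine  (λ eq → x≢y (sym eq)) (sym l≡)

  sameP : Flag π → Flag π → Bool
  sameP x y = does (pt x ≟ pt y)

  sameP-sym : ∀ x y → sameP x y ≡ sameP y x
  sameP-sym x y = does-⇔ (mk⇔ sym sym) (pt x ≟ pt y) (pt y ≟ pt x)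

  sameP-point : ∀ {x y} → sameP x y ≡ true → pt x ≡ pt y
  sameP-point {x} {y} _ with pt x ≟ pt y
  sameP-point _  | yes p≡ = p≡
  sameP-point () | no _

  sameP-line : ∀ {x y} → Adjacent x y → sameP x y ≡ false → ln x ≡ ln y
  sameP-line (viaPoint _ p≡) s = contradiction (trans (sym (dec-true (_ ≟ _) p≡)) s) λ ()
  sameP-line (viaLine  _ l≡) _ = l≡

  mixed-triangle : ∀ {x y z} → Adjacent x y → Adjacent x z →
                   pt x ≡ pt y → ln x ≡ ln z → ¬ Adjacent y z
  mixed-triangle xy xz px≡py lx≡lz (viaPoint _ py≡pz) = adjacent-≢ xz (flag-≡ (trans px≡py py≡pz) lx≡lz)
  mixed-triangle xy xz px≡py lx≡lz (viaLine _ ly≡lz)  = adjacent-≢ xy (flag-≡ px≡py (trans lx≡lz (sym ly≡lz)))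

  -- Two distinct neighbours of x are adjacent exactly when they are joined
  -- to x in the same way: the neighbourhood of x is a point-clique and a
  -- line-clique with no edges between them.
  neighbours-adjacent⇔ : ∀ {x y z} → Adjacent x y → Adjacent x z → y ≢ z →
                         Adjacent y z ⇔ (sameP x y ≡ sameP x z)
  neighbours-adjacent⇔ {x} {y} {z} xy xz y≢z = mk⇔ same-kind adjacent
    where
    same-kind : Adjacent y z → sameP x y ≡ sameP x z
    same-kind yz with sameP x y in sxy | sameP x z in sxz
    ... | true  | true  = refl
    ... | false | false = refl
    ... | true  | false = ⊥-elim (mixed-triangle xy xz (sameP-point {x} {y} sxy) (sameP-line xz sxz) yz)
    ... | false | true  = ⊥-elim (mixed-triangle xz xy (sameP-point {x} {z} sxz) (sameP-line xy sxy) (adjacent-sym yz))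
    adjacent : sameP x y ≡ sameP x z → Adjacent y z
    adjacent same with sameP x y in sxy
    ... | true  = viaPoint y≢z (trans (sym (sameP-point {x} {y} sxy)) (sameP-point {x} {z} (sym same)))
    ... | false = viaLine  y≢z (trans (sym (sameP-line xy sxy)) (sameP-line xz (sym same)))

  -- L(Γ_π) is connected: a function constant on adjacent flags is constant.
  -- Flags x, w are joined through (pt x, m) and (pt w, m), m the line pt x pt w.
  adjacency-invariant : {A : Set} (f : Flag π → A) → (∀ {x z} → Adjacent x z → f x ≡ f z) →
                        ∀ x w → f x ≡ f w
  adjacency-invariant f f-adj x w with pt x ≟ pt w
  ... | yes px≡pw = via-point px≡pw
    where
    via-point : ∀ {x z} → pt x ≡ pt z → f x ≡ f z
    via-point {x} {z} p≡ with flag-≟ x z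
    ... | yes refl = refl
    ... | no x≢z   = f-adj (viaPoint x≢z p≡)
  ... | no px≢pw with joinUnique (pt x) (pt w) px≢pw
  ... | m , px∈m , pw∈m , _ = begin
    f x                   ≡⟨ via-point refl ⟩
    f ((pt x , m) , px∈m) ≡⟨ via-line refl ⟩
    f ((pt w , m) , pw∈m) ≡⟨ via-point refl ⟩
    f w                   ∎
    where
    open ≡-Reasoning
    via-point : ∀ {x z} → pt x ≡ pt z → f x ≡ f z
    via-point {x} {z} p≡ with flag-≟ x z
    ... | yes refl = refl
    ... | no x≢z   = f-adj (viaPoint x≢z p≡)
    via-line : ∀ {x z} → ln x ≡ ln z → f x ≡ f z
    via-line {x} {z} l≡ with flag-≟ x z
    ... | yes refl = refl
    ... | no x≢z   = f-adj (viaLine x≢z l≡)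

  record IsEmbedding (ψ : Flag π → Flag π) : Set where
    field
      injective : ∀ {x y} → ψ x ≡ ψ y → x ≡ y
      preserves : ∀ {x y} → Adjacent x y → Adjacent (ψ x) (ψ y)
      reflects  : ∀ {x y} → Adjacent (ψ x) (ψ y) → Adjacent x y
  open IsEmbedding public

  -- ψ twists the adjacencies at x by c: it keeps their kind (shared point
  -- or shared line) if c = false and exchanges it if c = true.
  TwistsAt : (Flag π → Flag π) → Flag π → Bool → Set
  TwistsAt ψ x c = ∀ {z} → Adjacent x z → sameP (ψ x) (ψ z) ≡ sameP x z xor c

  Twists : (Flag π → Flag π) → Bool → Set
  Twists ψ c = ∀ x → TwistsAt ψ x c

  twists-≗ : ∀ {ψ χ c} → (∀ x → ψ x ≡ χ x) → Twists χ c → Twists ψ c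
  twists-≗ {ψ} {χ} ψ≗χ χ-twists x {z} xz = trans (cong₂ sameP (ψ≗χ x) (ψ≗χ z)) (χ-twists x xz)

  twists-∘ : ∀ {ψ χ c d} → IsEmbedding ψ → Twists ψ c → Twists χ d →
             Twists (λ x → χ (ψ x)) (c xor d)
  twists-∘ {ψ} {χ} {c} {d} ψ-emb ψ-twists χ-twists x {z} xz = begin
    sameP (χ (ψ x)) (χ (ψ z)) ≡⟨ χ-twists (ψ x) (preserves ψ-emb xz) ⟩
    sameP (ψ x) (ψ z) xor d   ≡⟨ cong (_xor d) (ψ-twists x xz) ⟩
    (sameP x z xor c) xor d   ≡⟨ xor-assoc (sameP x z) c d ⟩
    sameP x z xor (c xor d)   ∎
    where open ≡-Reasoning

  module _ {ψ : Flag π → Flag π} (ψ-emb : IsEmbedding ψ) (keeps : Twists ψ false) where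

    common-point : ∀ {x z} → pt x ≡ pt z → pt (ψ x) ≡ pt (ψ z)
    common-point {x} {z} p≡ with flag-≟ x z
    ... | yes refl = refl
    ... | no x≢z   = sameP-point {ψ x} {ψ z} (begin
      sameP (ψ x) (ψ z)   ≡⟨ keeps x (viaPoint x≢z p≡) ⟩
      sameP x z xor false ≡⟨ cong (_xor false) (dec-true (pt x ≟ pt z) p≡) ⟩
      true                ∎)
      where open ≡-Reasoning

    common-line : ∀ {x z} → ln x ≡ ln z → ln (ψ x) ≡ ln (ψ z)
    common-line {x} {z} l≡ with flag-≟ x z
    ... | yes refl = refl
    ... | no x≢z   = sameP-line (preserves ψ-emb xz) (begin
      sameP (ψ x) (ψ z)   ≡⟨ keeps x xz ⟩
      sameP x z xor false ≡⟨ cong (_xor false) (dec-false (pt x ≟ pt z) (λ p≡ → x≢z (flag-≡ p≡ l≡))) ⟩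
      false               ∎)
      where
      open ≡-Reasoning
      xz : Adjacent x z
      xz = viaLine x≢z l≡

-- In a plane of order 0 each point is on a single line and each line has
-- a single point, so no two flags are adjacent.
order-zero-no-adjacency : (π : ProjectivePlane 0) → ∀ {x y} → ¬ LineGraph.Adjacent π x y
order-zero-no-adjacency π {x} {y} xy = adjacent-≢ xy (flag-≡ (point-shared xy) (line-shared xy))
  where
  open ProjectivePlane π
  open LineGraph π
  singleton : {A : Set} → Fin 1 ↔ A → (a a′ : A) → a ≡ a′
  singleton e a a′ = begin
    a                    ≡⟨ sym (strictlyInverseˡ e a) ⟩
    to e (from e a)      ≡⟨ cong (to e) (fin1 (from e a) (from e a′)) ⟩
    to e (from e a′)     ≡⟨ strictlyInverseˡ e a′ ⟩
    a′                   ∎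
    where
    open ≡-Reasoning
    fin1 : (i j : Fin 1) → i ≡ j
    fin1 zero zero = refl
  point-shared : Adjacent x y → pt x ≡ pt y
  point-shared (viaPoint _ p≡) = p≡
  point-shared (viaLine  _ l≡) = cong proj₁ (singleton (linePoints (ln x)) (pt x , proj₂ x)
                                   (pt y , subst (λ l → I (pt y) l ≡ true) (sym l≡) (proj₂ y)))
  line-shared : Adjacent x y → ln x ≡ ln y
  line-shared (viaLine  _ l≡) = l≡
  line-shared (viaPoint _ p≡) = cong proj₁ (singleton (pointLines (pt x)) (ln x , proj₂ x)
                                   (ln y , subst (λ p → I p (ln y) ≡ true) (sym p≡) (proj₂ y)))

-- Whitney-type rigidity: in a plane of order ≥ 1 every embedding of
-- L(Γ_π) twists all adjacencies by one and the same constant.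

module UniformTwist {q : ℕ} (π : ProjectivePlane (suc q)) where
  open ProjectivePlane π
  open PlaneCounting π using (LinesThrough)
  open LineGraph π

  -- Each point is on q + 2 ≥ 2 lines, so each flag x has a neighbour
  -- sharing its point.
  point-neighbour : (x : Flag π) → Σ[ y ∈ Flag π ] (Adjacent x y × pt x ≡ pt y)
  point-neighbour x = y , viaPoint x≢y refl , refl
    where
    other : LinesThrough (pt x) ∖ (ln x , proj₂ x)
    other = to (remove-↔ (pointLines (pt x)) (ln x , proj₂ x)) zero
    y : Flag π
    y = (pt x , proj₁ (elem other)) , proj₂ (elem other)
    x≢y : x ≢ y
    x≢y eq = distinct′ other (guarded-≡ (I (pt x)) (cong ln (sym eq)))

  -- Twists are unique: compare them on an adjacent pair.
  twist-unique : ∀ {ψ c d} → Flag π → Twists ψ c → Twists ψ d → c ≡ d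
  twist-unique {ψ} {c} {d} x₀ ψ-c ψ-d =
    xor-cancelˡ (sameP x₀ y₀) (trans (sym (ψ-c x₀ x₀y₀)) (ψ-d x₀ x₀y₀))
    where
    y₀ : Flag π
    y₀ = proj₁ (point-neighbour x₀)
    x₀y₀ : Adjacent x₀ y₀
    x₀y₀ = proj₁ (proj₂ (point-neighbour x₀))

  module _ {ψ : Flag π → Flag π} (ψ-emb : IsEmbedding ψ) where

    twistAt : Flag π → Bool
    twistAt x = not (sameP (ψ x) (ψ (proj₁ (point-neighbour x))))

    -- Among the neighbours z of x, ψ x ψ z has the kind of ψ x ψ y exactly
    -- when z shares the point of x, because both say that z lies in the
    -- clique of y at x.
    twists-locally : ∀ x → TwistsAt ψ x (twistAt x)
    twists-locally x {z} xz =
      xor-shift (sameP (ψ x) (ψ z)) (sameP x z) (sameP (ψ x) (ψ y)) (relative-kind (flag-≟ y z))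
      where
      y : Flag π
      y = proj₁ (point-neighbour x)
      xy : Adjacent x y
      xy = proj₁ (proj₂ (point-neighbour x))
      sxy : sameP x y ≡ true
      sxy = dec-true (pt x ≟ pt y) (proj₂ (proj₂ (point-neighbour x)))
      relative-kind : Dec (y ≡ z) → (sameP (ψ x) (ψ z) ≡ sameP (ψ x) (ψ y) ⇔ sameP x z ≡ true)
      relative-kind (yes refl) = mk⇔ (λ _ → sxy) (λ _ → refl)
      relative-kind (no y≢z)   = mk⇔
        (λ same-image → trans (sym (Equivalence.to (neighbours-adjacent⇔ xy xz y≢z)
                          (reflects ψ-emb (Equivalence.from image⇔ (sym same-image))))) sxy)
        (λ sxz → sym (Equivalence.to image⇔ (preserves ψ-emb
                   (Equivalence.from (neighbours-adjacent⇔ xy xz y≢z) (trans sxy (sym sxz))))))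
        where
        image⇔ : Adjacent (ψ y) (ψ z) ⇔ (sameP (ψ x) (ψ y) ≡ sameP (ψ x) (ψ z))
        image⇔ = neighbours-adjacent⇔ (preserves ψ-emb xy) (preserves ψ-emb xz)
                                       (λ eq → y≢z (injective ψ-emb eq))

    -- Adjacent flags have the same twist, as kinds are symmetric.
    twistAt-adjacent : ∀ {x z} → Adjacent x z → twistAt x ≡ twistAt z
    twistAt-adjacent {x} {z} xz = xor-cancelˡ (sameP x z) (begin
      sameP x z xor twistAt x ≡⟨ sym (twists-locally x xz) ⟩
      sameP (ψ x) (ψ z)       ≡⟨ sameP-sym (ψ x) (ψ z) ⟩
      sameP (ψ z) (ψ x)       ≡⟨ twists-locally z (adjacent-sym xz) ⟩
      sameP z x xor twistAt z ≡⟨ cong (_xor twistAt z) (sameP-sym z x) ⟩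
      sameP x z xor twistAt z ∎)
      where open ≡-Reasoning

    -- By connectivity, ψ twists everything by the twist at any x₀.
    twists : ∀ x₀ → Twists ψ (twistAt x₀)
    twists x₀ x = subst (TwistsAt ψ x) (adjacency-invariant twistAt twistAt-adjacent x x₀) (twists-locally x)

-- The part of a Cayley structure on L(Γ_π) that the argument uses: a group
-- G, a bijection φ (up to ≈) from the flags onto G, and a set S with
-- x ~ y iff φ x ∙ (φ y)⁻¹ ∈ S.
record CayleyLabelling {q : ℕ} (π : ProjectivePlane q) : Set₁ where
  field
    G : Group 0ℓ 0ℓ
  open Group G using (Carrier; _≈_; _∙_; _⁻¹)
  field
    S            : Carrier → Set
    S-resp       : ∀ {g h} → g ≈ h → S g → S h
    φ            : Flag π → Carrier
    φ-injective  : ∀ x y → φ x ≈ φ y → x ≡ y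
    φ-surjective : ∀ g → Σ[ x ∈ Flag π ] φ x ≈ g
    φ-adjacency  : ∀ x y → LineGraphAdj π x y ⇔ S (φ x ∙ φ y ⁻¹)

cayley-labelling : ∀ {q} {π : ProjectivePlane q} →
                   IsCayleyGraph (LineGraphOfIncidenceGraph π) → CayleyLabelling π
cayley-labelling (G , _ , S , S-resp , _ , _ , φ , φ-injective , φ-surjective , φ-adjacency) =
  record { G = G ; S = S ; S-resp = S-resp ; φ = φ ; φ-injective = φ-injective
         ; φ-surjective = φ-surjective ; φ-adjacency = φ-adjacency }

module CayleyAction {q : ℕ} {π : ProjectivePlane q} (L : CayleyLabelling π) where
  open CayleyLabelling L public
  open Group G public renaming (refl to ≈-refl; sym to ≈-sym; trans to ≈-trans)
  open GroupProperties G using (⁻¹-anti-homo-∙; ∙-cancelˡ)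
  open LineGraph π

  act : Carrier → Flag π → Flag π
  act h x = proj₁ (φ-surjective (φ x ∙ h))

  φ-act : ∀ h x → φ (act h x) ≈ φ x ∙ h
  φ-act h x = proj₂ (φ-surjective (φ x ∙ h))

  act-cong : ∀ {g h} x → g ≈ h → act g x ≡ act h x
  act-cong {g} {h} x g≈h = φ-injective _ _
    (≈-trans (φ-act g x) (≈-trans (∙-congˡ g≈h) (≈-sym (φ-act h x))))

  act-ε : ∀ x → act ε x ≡ x
  act-ε x = φ-injective _ _ (≈-trans (φ-act ε x) (identityʳ (φ x)))

  act-∙ : ∀ g h x → act (g ∙ h) x ≡ act h (act g x)
  act-∙ g h x = φ-injective _ _ (begin
    φ (act (g ∙ h) x)     ≈⟨ φ-act (g ∙ h) x ⟩
    φ x ∙ (g ∙ h)         ≈⟨ ≈-sym (assoc (φ x) g h) ⟩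
    (φ x ∙ g) ∙ h         ≈⟨ ∙-congʳ (≈-sym (φ-act g x)) ⟩
    φ (act g x) ∙ h       ≈⟨ ≈-sym (φ-act h (act g x)) ⟩
    φ (act h (act g x))   ∎)
    where open SetoidReasoning setoid

  act-inverseˡ : ∀ h x → act (h ⁻¹) (act h x) ≡ x
  act-inverseˡ h x = trans (sym (act-∙ h (h ⁻¹) x)) (trans (act-cong x (inverseʳ h)) (act-ε x))

  act-inverseʳ : ∀ h x → act h (act (h ⁻¹) x) ≡ x
  act-inverseʳ h x = trans (sym (act-∙ (h ⁻¹) h x)) (trans (act-cong x (inverseˡ h)) (act-ε x))

  act-↔ : Carrier → Flag π ↔ Flag π
  act-↔ h = mk↔ₛ′ (act h) (act (h ⁻¹)) (act-inverseʳ h) (act-inverseˡ h)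

  act-transitive : ∀ x y → act (φ x ⁻¹ ∙ φ y) x ≡ y
  act-transitive x y = φ-injective _ _ (begin
    φ (act (φ x ⁻¹ ∙ φ y) x) ≈⟨ φ-act (φ x ⁻¹ ∙ φ y) x ⟩
    φ x ∙ (φ x ⁻¹ ∙ φ y)     ≈⟨ ≈-sym (assoc (φ x) (φ x ⁻¹) (φ y)) ⟩
    (φ x ∙ φ x ⁻¹) ∙ φ y     ≈⟨ ∙-congʳ (inverseʳ (φ x)) ⟩
    ε ∙ φ y                  ≈⟨ identityˡ (φ y) ⟩
    φ y                      ∎)
    where open SetoidReasoning setoid

  act-free : ∀ {g h} x → act g x ≡ act h x → g ≈ h
  act-free {g} {h} x eq = ∙-cancelˡ (φ x) g h (begin
    φ x ∙ g         ≈⟨ ≈-sym (φ-act g x) ⟩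
    φ (act g x)     ≡⟨ cong φ eq ⟩
    φ (act h x)     ≈⟨ φ-act h x ⟩
    φ x ∙ h         ∎)
    where open SetoidReasoning setoid

  -- Right multiplication does not change φ x ∙ (φ y)⁻¹, which determines adjacency.
  difference-invariant : ∀ h x y → φ (act h x) ∙ φ (act h y) ⁻¹ ≈ φ x ∙ φ y ⁻¹
  difference-invariant h x y = begin
    φ (act h x) ∙ φ (act h y) ⁻¹ ≈⟨ ∙-cong (φ-act h x) (⁻¹-cong (φ-act h y)) ⟩
    (φ x ∙ h) ∙ (φ y ∙ h) ⁻¹     ≈⟨ ∙-congˡ (⁻¹-anti-homo-∙ (φ y) h) ⟩
    (φ x ∙ h) ∙ (h ⁻¹ ∙ φ y ⁻¹)  ≈⟨ assoc (φ x) h (h ⁻¹ ∙ φ y ⁻¹) ⟩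
    φ x ∙ (h ∙ (h ⁻¹ ∙ φ y ⁻¹))  ≈⟨ ∙-congˡ (≈-sym (assoc h (h ⁻¹) (φ y ⁻¹))) ⟩
    φ x ∙ ((h ∙ h ⁻¹) ∙ φ y ⁻¹)  ≈⟨ ∙-congˡ (∙-congʳ (inverseʳ h)) ⟩
    φ x ∙ (ε ∙ φ y ⁻¹)           ≈⟨ ∙-congˡ (identityˡ (φ y ⁻¹)) ⟩
    φ x ∙ φ y ⁻¹                 ∎
    where open SetoidReasoning setoid

  act-embedding : ∀ h → IsEmbedding (act h)
  act-embedding h = record
    { injective = λ {x} {y} eq → trans (sym (act-inverseˡ h x)) (trans (cong (act (h ⁻¹)) eq) (act-inverseˡ h y))
    ; preserves = λ {x} {y} xy → adjacency-from (S-resp (≈-sym (difference-invariant h x y)) (adjacency-to xy))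
    ; reflects  = λ {x} {y} xy → adjacency-from (S-resp (difference-invariant h x y) (adjacency-to xy))
    }
    where
    adjacency-to : ∀ {x y} → Adjacent x y → S (φ x ∙ φ y ⁻¹)
    adjacency-to {x} {y} xy = Equivalence.to (φ-adjacency x y) (Equivalence.to (adjacent⇔ x y) xy)
    adjacency-from : ∀ {x y} → S (φ x ∙ φ y ⁻¹) → Adjacent x y
    adjacency-from {x} {y} s = Equivalence.from (adjacent⇔ x y) (Equivalence.from (φ-adjacency x y) s)

-- For even order q ≥ 1 no element of G exchanges the kinds of adjacencies:
-- the twist is a homomorphism G → (Bool, xor), and an element of twist
-- true would flip the labelling x ↦ twist (φ x) of the flags, forcing an
-- even number of flags.

module CayleyTwist {q : ℕ} {π : ProjectivePlane (suc q)} (L : CayleyLabelling π) where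
  open ProjectivePlane π using (v)
  open CayleyAction L
  open LineGraph π
  open UniformTwist π
  open PlaneCounting π using (flag-↔; point-count)

  x₀ : Flag π
  x₀ = proj₁ (φ-surjective ε)

  twist : Carrier → Bool
  twist h = twistAt (act-embedding h) x₀

  act-twists : ∀ h → Twists (act h) (twist h)
  act-twists h = twists (act-embedding h) x₀

  twist-cong : ∀ {g h} → g ≈ h → twist g ≡ twist h
  twist-cong {g} {h} g≈h =
    twist-unique {act g} x₀ (act-twists g) (twists-≗ {act g} (λ x → act-cong x g≈h) (act-twists h))

  twist-homomorphism : ∀ g h → twist (g ∙ h) ≡ twist g xor twist h
  twist-homomorphism g h = twist-unique {act (g ∙ h)} x₀ (act-twists (g ∙ h))
    (twists-≗ {act (g ∙ h)} {λ x → act h (act g x)} (act-∙ g h) (twists-∘ {act g} {act h} (act-embedding g) (act-twists g) (act-twists h)))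

  no-twist : 2 ∣ suc q → ∀ h → twist h ≡ false
  no-twist 2∣q h with twist h in twist-h
  ... | false = refl
  ... | true  = ⊥-elim (flag-count-odd (suc q) 2∣q
                  (subst (λ n → 2 ∣ n * suc (suc q)) (point-count (pt x₀)) flags-even))
    where
    label : Flag π → Bool
    label x = twist (φ x)
    flips : ∀ x → label (act h x) ≡ not (label x)
    flips x = begin
      twist (φ (act h x))     ≡⟨ twist-cong (φ-act h x) ⟩
      twist (φ x ∙ h)         ≡⟨ twist-homomorphism (φ x) h ⟩
      twist (φ x) xor twist h ≡⟨ cong (twist (φ x) xor_) twist-h ⟩
      twist (φ x) xor true    ≡⟨ xor-comm (twist (φ x)) true ⟩
      not (twist (φ x))       ∎
      where open ≡-Reasoning
    flags-even : 2 ∣ v * suc (suc q)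
    flags-even = flip⇒even flag-↔ (act-↔ h) label flips

  keeps-kinds : 2 ∣ suc q → ∀ h → Twists (act h) false
  keeps-kinds 2∣q h = subst (Twists (act h)) (no-twist 2∣q h) (act-twists h)

cayley-keeps-kinds : ∀ q → 2 ∣ q → (π : ProjectivePlane q) (L : CayleyLabelling π) →
                     ∀ h → LineGraph.Twists π (CayleyAction.act L h) false
cayley-keeps-kinds zero    _   π _ _ _ xz = ⊥-elim (order-zero-no-adjacency π xz)
cayley-keeps-kinds (suc q) 2∣q π L = CayleyTwist.keeps-kinds L 2∣q

module FlagRegularGroup {q : ℕ} {π : ProjectivePlane q} (L : CayleyLabelling π)
  (keeps : ∀ h → LineGraph.Twists π (CayleyAction.act L h) false) where
  open ProjectivePlane π
  open CayleyAction L
  open LineGraph π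
  open Collineation

  flagAt : Fin v → Flag π
  flagAt p = (p , proj₁ (to (pointLines p) zero)) , proj₂ (to (pointLines p) zero)

  flagOn : Fin b → Flag π
  flagOn l = (proj₁ (to (linePoints l) zero) , l) , proj₂ (to (linePoints l) zero)

  -- The point and line maps of act h; they do not depend on the chosen
  -- flags since act h respects common points and common lines.
  pointMap : Carrier → Fin v → Fin v
  pointMap h p = pt (act h (flagAt p))

  lineMap : Carrier → Fin b → Fin b
  lineMap h l = ln (act h (flagOn l))

  pointMap-pt : ∀ h x → pointMap h (pt x) ≡ pt (act h x)
  pointMap-pt h x = common-point (act-embedding h) (keeps h) refl

  lineMap-ln : ∀ h x → lineMap h (ln x) ≡ ln (act h x)
  lineMap-ln h x = common-line (act-embedding h) (keeps h) refl

  pointMap-∙ : ∀ g h p → pointMap (g ∙ h) p ≡ pointMap h (pointMap g p)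
  pointMap-∙ g h p = trans (cong pt (act-∙ g h (flagAt p))) (sym (pointMap-pt h (act g (flagAt p))))

  lineMap-∙ : ∀ g h l → lineMap (g ∙ h) l ≡ lineMap h (lineMap g l)
  lineMap-∙ g h l = trans (cong ln (act-∙ g h (flagOn l))) (sym (lineMap-ln h (act g (flagOn l))))

  pointMap-inverseˡ : ∀ h p → pointMap (h ⁻¹) (pointMap h p) ≡ p
  pointMap-inverseˡ h p = trans (pointMap-pt (h ⁻¹) (act h (flagAt p))) (cong pt (act-inverseˡ h (flagAt p)))

  pointMap-inverseʳ : ∀ h p → pointMap h (pointMap (h ⁻¹) p) ≡ p
  pointMap-inverseʳ h p = trans (pointMap-pt h (act (h ⁻¹) (flagAt p))) (cong pt (act-inverseʳ h (flagAt p)))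

  lineMap-inverseˡ : ∀ h l → lineMap (h ⁻¹) (lineMap h l) ≡ l
  lineMap-inverseˡ h l = trans (lineMap-ln (h ⁻¹) (act h (flagOn l))) (cong ln (act-inverseˡ h (flagOn l)))

  lineMap-inverseʳ : ∀ h l → lineMap h (lineMap (h ⁻¹) l) ≡ l
  lineMap-inverseʳ h l = trans (lineMap-ln h (act (h ⁻¹) (flagOn l))) (cong ln (act-inverseʳ h (flagOn l)))

  -- Flags are mapped to flags; applying this to h⁻¹ gives the converse.
  incidence : ∀ h p l → I (pointMap h p) (lineMap h l) ≡ I p l
  incidence h p l = ⇔→≡ (mk⇔ reflected preserved)
    where
    maps-flags : ∀ g (x : Flag π) → I (pointMap g (pt x)) (lineMap g (ln x)) ≡ true
    maps-flags g x = trans (cong₂ I (pointMap-pt g x) (lineMap-ln g x)) (proj₂ (act g x))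
    preserved : I p l ≡ true → I (pointMap h p) (lineMap h l) ≡ true
    preserved p∈l = maps-flags h ((p , l) , p∈l)
    reflected : I (pointMap h p) (lineMap h l) ≡ true → I p l ≡ true
    reflected image∈ = trans (cong₂ I (sym (pointMap-inverseˡ h p)) (sym (lineMap-inverseˡ h l)))
                             (maps-flags (h ⁻¹) ((pointMap h p , lineMap h l) , image∈))

  collineation : Carrier → Collineation π
  collineation h = record
    { σ = permutation (pointMap h) (pointMap (h ⁻¹)) (pointMap-inverseʳ h) (pointMap-inverseˡ h)
    ; τ = permutation (lineMap h) (lineMap (h ⁻¹)) (lineMap-inverseʳ h) (lineMap-inverseˡ h)
    ; preserves = incidence h
    }

  Induced : Collineation π → Set
  Induced α = Σ[ h ∈ Carrier ] _≈c_ π α (collineation h)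

  induced-group : IsCollineationGroup π Induced
  induced-group = record
    { respects   = λ { α β (α≈βσ , α≈βτ) (h , α≈hσ , α≈hτ) →
                     h , (λ p → trans (sym (α≈βσ p)) (α≈hσ p)) , (λ l → trans (sym (α≈βτ l)) (α≈hτ l)) }
    ; hasId      = λ α idσ idτ → ε ,
                     (λ p → trans (idσ p) (sym (cong pt (act-ε (flagAt p))))) ,
                     (λ l → trans (idτ l) (sym (cong ln (act-ε (flagOn l)))))
    ; closedComp = λ { α β γ (h , α≈hσ , α≈hτ) (g , β≈gσ , β≈gτ) γσ γτ → g ∙ h ,
                     (λ p → trans (γσ p) (trans (α≈hσ _) (trans (cong (pointMap h) (β≈gσ p)) (sym (pointMap-∙ g h p))))) ,
                     (λ l → trans (γτ l) (trans (α≈hτ _) (trans (cong (lineMap h) (β≈gτ l)) (sym (lineMap-∙ g h l))))) }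
    ; closedInv  = λ { α β (h , α≈hσ , α≈hτ) βσ βτ → h ⁻¹ ,
                     (λ p → trans (βσ p) (⟨$⟩ˡ-unique (σ α) (trans (α≈hσ _) (pointMap-inverseʳ h p)))) ,
                     (λ l → trans (βτ l) (⟨$⟩ˡ-unique (τ α) (trans (α≈hτ _) (lineMap-inverseʳ h l)))) }
    }

  maps-flag : ∀ α h f f′ → _≈c_ π α (collineation h) → MapsFlag π α f f′ → act h f ≡ f′
  maps-flag α h f f′ (α≈hσ , α≈hτ) (σf , τf) =
    flag-≡ (trans (sym (pointMap-pt h f)) (trans (sym (α≈hσ (pt f))) σf))
           (trans (sym (lineMap-ln h f)) (trans (sym (α≈hτ (ln f))) τf))

  induced-regular : ActsRegularlyOnFlags π Induced
  induced-regular f f′ = (collineation h , (h , (λ _ → refl) , (λ _ → refl)) , maps) , unique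
    where
    h : Carrier
    h = φ f ⁻¹ ∙ φ f′
    maps : MapsFlag π (collineation h) f f′
    maps = trans (pointMap-pt h f) (cong pt (act-transitive f f′)) ,
           trans (lineMap-ln h f) (cong ln (act-transitive f f′))
    unique : ∀ α β → Induced α → Induced β → MapsFlag π α f f′ → MapsFlag π β f f′ → _≈c_ π α β
    unique α β (g , α≈g) (g′ , β≈g′) α-maps β-maps =
      (λ p → trans (proj₁ α≈g p) (trans (cong pt (act-cong (flagAt p) g≈g′)) (sym (proj₁ β≈g′ p)))) ,
      (λ l → trans (proj₂ α≈g l) (trans (cong ln (act-cong (flagOn l) g≈g′)) (sym (proj₂ β≈g′ l))))
      where
      g≈g′ : g ≈ g′
      g≈g′ = act-free f (trans (maps-flag α g f f′ α≈g α-maps) (sym (maps-flag β g′ f f′ β≈g′ β-maps)))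

  flag-regular-group : HasFlagRegularCollineationGroup π
  flag-regular-group = Induced , induced-group , induced-regular

lemma5p4 : (q : ℕ) → 2 ∣ q → (π : ProjectivePlane q) →
           IsCayleyGraph (LineGraphOfIncidenceGraph π) →
           HasFlagRegularCollineationGroup π
lemma5p4 q 2∣q π cayley = FlagRegularGroup.flag-regular-group L (cayley-keeps-kinds q 2∣q π L)
  where
  L : CayleyLabelling π
  L = cayley-labelling cayley
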